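{- Let $t$ be an integer and let $\lambda=(a,1^b)$ be a hook partition with $a\ge1$, $b\ge0$. Then $c^\lambda_{sp}(i,j)\ne t$ for all cells $(i,j)\in\lambda$ if and only if all of the following hold: (i) $b\neq -t/2$; (ii) if $a\ge 2$, then $b<1-t$ or $a-b-1<t$; (iii) if $b\ge1$, then $t<a-b+1$ or $a<t$.
   Context: The notation $(a,1^b)$ denotes the partition with one part $a$ followed by $b$ parts equal to $1$. For a partition $\lambda$ with conjugate $\lambda'$ (cells $(i,j)$ = row $i$, column $j$ of the Young diagram; $\lambda_i=0$ beyond the length), the symplectic content of a cell $(i,j)\in\lambda$ is $c^\lambda_{sp}(i,j)=\lambda_i+\lambda_j-i-j+2$ if $i>j$, and $c^\lambda_{sp}(i,j)=i+j-\lambda'_i-\lambda'_j$ if $i\le j$. -}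

module Defs where

open import Data.Nat as ℕ using (ℕ; zero; suc; _≤_; _≤ᵇ_)
open import Data.Integer as ℤ using (ℤ; +_)
open import Data.List using (List; []; _∷_; replicate; length; filter)
open import Data.Bool using (if_then_else_; true; false)
open import Data.Product using (_×_)

-- A partition is represented by its list of (weakly decreasing, positive) parts.
Partition : Set
Partition = List ℕ

-- part p i  =  λ_i  (1-indexed; 0 beyond the length)
part : Partition → ℕ → ℕ
part []       _             = 0
part (x ∷ xs) zero          = 0
part (x ∷ xs) (suc zero)    = x
part (x ∷ xs) (suc (suc i)) = part xs (suc i)

conj : Partition → ℕ → ℕ
conj []       j = 0
conj (x ∷ xs) j = if j ≤ᵇ x then suc (conj xs j) else conj xs j

IsCell : Partition → ℕ → ℕ → Set
IsCell p i j = (1 ≤ i) × (1 ≤ j) × (j ≤ part p i)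

csp : Partition → ℕ → ℕ → ℤ
csp p i j with j ℕ.<ᵇ i
... | true  = (+ part p i) ℤ.+ (+ part p j) ℤ.- (+ i) ℤ.- (+ j) ℤ.+ (+ 2)
... | false = (+ i) ℤ.+ (+ j) ℤ.- (+ conj p i) ℤ.- (+ conj p j)

hook : ℕ → ℕ → Partition
hook a b = a ∷ replicate b 1

-- The cells of (a, 1^b) are the corner (1,1), the arm (1,j) with 2 ≤ j ≤ a and the
-- leg (i,1) with 2 ≤ i ≤ b+1.  Their symplectic contents are -2b, j-b-1 and a+2-i, so
-- the arm contents fill the integer interval [1-b, a-b-1] and the leg contents fill
-- [a-b+1, a].  Avoiding t is therefore t ≠ -2b together with t lying outside both
-- intervals whenever they are nonempty, which are conditions (i)-(iii).
module Submission where

open import Defs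
open import Data.Nat as ℕ using (ℕ; zero; suc; z≤n; s≤s)
import Data.Nat.Properties as ℕ
open import Data.Integer as ℤ using (ℤ; +_; -_; -[1+_]; _+_; _-_; _*_; _<_; +<+; -<+)
import Data.Integer.Properties as ℤ
open import Data.Integer.Tactic.RingSolver using (solve)
open import Data.Bool using (true)
open import Data.List using ([]; _∷_; replicate)
open import Data.Product using (_×_; _,_)
open import Data.Sum using (_⊎_; inj₁; inj₂; swap)
open import Data.Sum.Function.Propositional using (_⊎-⇔_)
open import Data.Product.Function.NonDependent.Propositional using (_×-⇔_)
open import Function.Bundles using (_⇔_; mk⇔; Equivalence)
open import Function.Related.TypeIsomorphisms using (→-cong-⇔; ¬-cong-⇔)
import Function.Properties.Equivalence as ⇔
open import Relation.Nullary using (yes; no; contradiction)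
open import Relation.Binary.PropositionalEquality using (_≡_; _≢_; refl; sym; cong; cong₂; subst₂; module ≡-Reasoning)

open ≡-Reasoning

+-cancelʳ-<⇔ : ∀ c {i j i′ j′} → i + c ≡ i′ → j + c ≡ j′ → i′ < j′ ⇔ i < j
+-cancelʳ-<⇔ c {i} {j} refl refl = mk⇔ cancel (ℤ.+-monoˡ-< c)
  where
  cancel : i + c < j + c → i < j
  cancel p = subst₂ _<_ (+-c-c i) (+-c-c j) (ℤ.+-monoˡ-< (- c) p)
    where
    +-c-c : ∀ k → k + c - c ≡ k
    +-c-c k = solve (k ∷ c ∷ [])

i-j≡k⇔i≡k+j : ∀ i j k → i - j ≡ k ⇔ i ≡ k + j
i-j≡k⇔i≡k+j i j k = mk⇔ (λ { refl → solve (i ∷ j ∷ []) }) (λ { refl → solve (k ∷ j ∷ []) })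

i-j≡k⇔j≡i-k : ∀ i j k → i - j ≡ k ⇔ j ≡ i - k
i-j≡k⇔j≡i-k i j k = mk⇔ (λ { refl → solve (i ∷ j ∷ []) }) (λ { refl → solve (i ∷ k ∷ []) })

-i≡j⇔i≡-j : ∀ i j → - i ≡ j ⇔ i ≡ - j
-i≡j⇔i≡-j i j = mk⇔ (λ { refl → sym (ℤ.neg-involutive i) }) (λ { refl → ℤ.neg-involutive j })

avoids-range⇔outside-range : ∀ {m M} k →
  (∀ n → m ℕ.≤ n → n ℕ.≤ M → + n ≢ k) ⇔ (m ℕ.≤ M → k < + m ⊎ + M < k)
avoids-range⇔outside-range {m} {M} k = mk⇔ (outside k) avoids
  where
  outside : ∀ k → (∀ n → m ℕ.≤ n → n ℕ.≤ M → + n ≢ k) → m ℕ.≤ M → k < + m ⊎ + M < k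
  outside -[1+ _ ] _ _ = inj₁ -<+
  outside (+ n)    H _ with n ℕ.<? m | M ℕ.<? n
  ... | yes n<m | _       = inj₁ (+<+ n<m)
  ... | no _    | yes M<n = inj₂ (+<+ M<n)
  ... | no n≮m  | no M≮n  = contradiction refl (H n (ℕ.≮⇒≥ n≮m) (ℕ.≮⇒≥ M≮n))
  avoids : (m ℕ.≤ M → k < + m ⊎ + M < k) → ∀ n → m ℕ.≤ n → n ℕ.≤ M → + n ≢ k
  avoids G n m≤n n≤M refl with G (ℕ.≤-trans m≤n n≤M)
  ... | inj₁ (+<+ n<m) = ℕ.<⇒≱ n<m m≤n
  ... | inj₂ (+<+ M<n) = ℕ.<⇒≱ M<n n≤M

∀-range-cong : ∀ {m M} {P Q : ℕ → Set} → (∀ n → m ℕ.≤ n → n ℕ.≤ M → P n ⇔ Q n) →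
  (∀ n → m ℕ.≤ n → n ℕ.≤ M → P n) ⇔ (∀ n → m ℕ.≤ n → n ℕ.≤ M → Q n)
∀-range-cong P⇔Q = mk⇔
  (λ H n m≤n n≤M → Equivalence.to   (P⇔Q n m≤n n≤M) (H n m≤n n≤M))
  (λ H n m≤n n≤M → Equivalence.from (P⇔Q n m≤n n≤M) (H n m≤n n≤M))

conj-replicate-1 : ∀ b → conj (replicate b 1) 1 ≡ b
conj-replicate-1 zero    = refl
conj-replicate-1 (suc b) = cong suc (conj-replicate-1 b)

conj-replicate-≥2 : ∀ b j → conj (replicate b 1) (suc (suc j)) ≡ 0
conj-replicate-≥2 zero    j = refl
conj-replicate-≥2 (suc b) j = conj-replicate-≥2 b j

part-replicate-≤1 : ∀ b i → part (replicate b 1) i ℕ.≤ 1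
part-replicate-≤1 zero    i             = z≤n
part-replicate-≤1 (suc b) zero          = z≤n
part-replicate-≤1 (suc b) (suc zero)    = s≤s z≤n
part-replicate-≤1 (suc b) (suc (suc i)) = part-replicate-≤1 b (suc i)

part-replicate-1 : ∀ {b i} → i ℕ.< b → part (replicate b 1) (suc i) ≡ 1
part-replicate-1 {suc b} {zero}  _       = refl
part-replicate-1 {suc b} {suc i} (s≤s i<b) = part-replicate-1 i<b

part-replicate-pos : ∀ b i → 1 ℕ.≤ part (replicate b 1) (suc i) → i ℕ.< b
part-replicate-pos (suc b) zero    _ = s≤s z≤n
part-replicate-pos (suc b) (suc i) p = s≤s (part-replicate-pos b i p)

conj-hook-1 : ∀ a b → conj (hook (suc a) b) 1 ≡ suc b
conj-hook-1 a b = cong suc (conj-replicate-1 b)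

conj-hook-arm : ∀ {a b j} → 2 ℕ.≤ j → j ℕ.≤ a → conj (hook a b) j ≡ 1
conj-hook-arm {a} {b} {suc (suc j)} (s≤s (s≤s _)) j≤a with suc (suc j) ℕ.≤ᵇ a | ℕ.≤⇒≤ᵇ j≤a
... | true | _ = cong suc (conj-replicate-≥2 b j)

data HookCell (a b : ℕ) : ℕ → ℕ → Set where
  corner : HookCell a b 1 1
  arm    : ∀ {j} → 2 ℕ.≤ j → j ℕ.≤ a → HookCell a b 1 j
  leg    : ∀ {i} → 2 ℕ.≤ i → i ℕ.≤ suc b → HookCell a b i 1

IsCell⇒HookCell : ∀ a b i j → IsCell (hook (suc a) b) i j → HookCell (suc a) b i j
IsCell⇒HookCell a b zero          _             (() , _)
IsCell⇒HookCell a b _             zero          (_ , () , _)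
IsCell⇒HookCell a b (suc zero)    (suc zero)    _                = corner
IsCell⇒HookCell a b (suc zero)    (suc (suc j)) (_ , _ , j≤a)    = arm (s≤s (s≤s z≤n)) j≤a
IsCell⇒HookCell a b (suc (suc i)) (suc zero)    (_ , _ , 1≤part) =
  leg (s≤s (s≤s z≤n)) (s≤s (part-replicate-pos b i 1≤part))
IsCell⇒HookCell a b (suc (suc i)) (suc (suc j)) (_ , _ , j≤part) =
  contradiction (ℕ.≤-trans j≤part (part-replicate-≤1 b (suc i))) λ { (s≤s ()) }

HookCell⇒IsCell : ∀ {a b i j} → HookCell (suc a) b i j → IsCell (hook (suc a) b) i j
HookCell⇒IsCell corner                          = s≤s z≤n , s≤s z≤n , s≤s z≤n
HookCell⇒IsCell (arm (s≤s (s≤s _)) j≤a)        = s≤s z≤n , s≤s z≤n , j≤a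
HookCell⇒IsCell (leg (s≤s (s≤s _)) (s≤s i<b)) =
  s≤s z≤n , s≤s z≤n , ℕ.≤-reflexive (sym (part-replicate-1 i<b))

∀-hookCell⇔ : ∀ a b (P : ℕ → ℕ → Set) →
  (∀ i j → IsCell (hook (suc a) b) i j → P i j)
    ⇔ (P 1 1 × (∀ j → 2 ℕ.≤ j → j ℕ.≤ suc a → P 1 j) × (∀ i → 2 ℕ.≤ i → i ℕ.≤ suc b → P i 1))
∀-hookCell⇔ a b P = mk⇔
  (λ H → at H corner , (λ j 2≤j j≤a → at H (arm 2≤j j≤a)) , (λ i 2≤i i≤b → at H (leg 2≤i i≤b)))
  (λ { (P₁₁ , P-arm , P-leg) i j c → by-cases P₁₁ P-arm P-leg (IsCell⇒HookCell a b i j c) })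
  where
  at : (∀ i j → IsCell (hook (suc a) b) i j → P i j) → ∀ {i j} → HookCell (suc a) b i j → P i j
  at H {i} {j} c = H i j (HookCell⇒IsCell c)
  by-cases : P 1 1 → (∀ j → 2 ℕ.≤ j → j ℕ.≤ suc a → P 1 j) → (∀ i → 2 ℕ.≤ i → i ℕ.≤ suc b → P i 1) →
    ∀ {i j} → HookCell (suc a) b i j → P i j
  by-cases P₁₁ _     _     corner        = P₁₁
  by-cases _   P-arm _     (arm 2≤j j≤a) = P-arm _ 2≤j j≤a
  by-cases _   _     P-leg (leg 2≤i i≤b) = P-leg _ 2≤i i≤b

csp-hook-corner : ∀ a b → csp (hook (suc a) b) 1 1 ≡ - (+ 2 * + b)
csp-hook-corner a b = begin
  + 1 + + 1 - + conj (hook (suc a) b) 1 - + conj (hook (suc a) b) 1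
    ≡⟨ cong (λ c → + 1 + + 1 - + c - + c) (conj-hook-1 a b) ⟩
  + 1 + + 1 - (+ 1 + + b) - (+ 1 + + b)
    ≡⟨ ring (+ b) ⟩
  - (+ 2 * + b) ∎
  where
  ring : ∀ k → + 1 + + 1 - (+ 1 + k) - (+ 1 + k) ≡ - (+ 2 * k)
  ring k = solve (k ∷ [])

csp-hook-arm : ∀ {a b j} → 2 ℕ.≤ j → j ℕ.≤ a → csp (hook a b) 1 j ≡ + j - (+ b + + 1)
csp-hook-arm {suc a} {b} {j} 2≤j@(s≤s (s≤s _)) j≤a = begin
  + 1 + + j - + conj (hook (suc a) b) 1 - + conj (hook (suc a) b) j
    ≡⟨ cong₂ (λ c c′ → + 1 + + j - + c - + c′) (conj-hook-1 a b) (conj-hook-arm {b = b} 2≤j j≤a) ⟩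
  + 1 + + j - (+ 1 + + b) - + 1
    ≡⟨ ring (+ j) (+ b) ⟩
  + j - (+ b + + 1) ∎
  where
  ring : ∀ k l → + 1 + k - (+ 1 + l) - + 1 ≡ k - (l + + 1)
  ring k l = solve (k ∷ l ∷ [])

csp-hook-leg : ∀ {a b i} → 2 ℕ.≤ i → i ℕ.≤ suc b → csp (hook a b) i 1 ≡ (+ a + + 2) - + i
csp-hook-leg {a} {b} {i@(suc (suc i′))} (s≤s (s≤s _)) (s≤s i′<b) = begin
  + part (hook a b) i + + a - + i - + 1 + + 2
    ≡⟨ cong (λ p → + p + + a - + i - + 1 + + 2) (part-replicate-1 i′<b) ⟩
  + 1 + + a - + i - + 1 + + 2
    ≡⟨ ring (+ a) (+ i) ⟩
  (+ a + + 2) - + i ∎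
  where
  ring : ∀ k l → + 1 + k - l - + 1 + + 2 ≡ (k + + 2) - l
  ring k l = solve (k ∷ l ∷ [])

avoids-corner⇔ : ∀ a b t → csp (hook (suc a) b) 1 1 ≢ t ⇔ + 2 * + b ≢ - t
avoids-corner⇔ a b t rewrite csp-hook-corner a b = ¬-cong-⇔ (-i≡j⇔i≡-j (+ 2 * + b) t)

avoids-arm⇔ : ∀ a b t →
  (∀ j → 2 ℕ.≤ j → j ℕ.≤ a → csp (hook a b) 1 j ≢ t)
    ⇔ (2 ℕ.≤ a → + b < + 1 - t ⊎ + a - + b - + 1 < t)
avoids-arm⇔ a b t = ⇔.trans (∀-range-cong solved-for-j)
  (⇔.trans (avoids-range⇔outside-range (t + (+ b + + 1)))
    (→-cong-⇔ ⇔.refl (below (+ b) ⊎-⇔ above (+ a) (+ b))))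
  where
  solved-for-j : ∀ j → 2 ℕ.≤ j → j ℕ.≤ a → csp (hook a b) 1 j ≢ t ⇔ + j ≢ t + (+ b + + 1)
  solved-for-j j 2≤j j≤a rewrite csp-hook-arm {b = b} 2≤j j≤a = ¬-cong-⇔ (i-j≡k⇔i≡k+j (+ j) (+ b + + 1) t)
  below : ∀ B → t + (B + + 1) < + 2 ⇔ B < + 1 - t
  below B = +-cancelʳ-<⇔ (t + + 1) {B} {+ 1 - t} {t + (B + + 1)} {+ 2} (solve (B ∷ t ∷ [])) (solve (t ∷ []))
  above : ∀ A B → A < t + (B + + 1) ⇔ A - B - + 1 < t
  above A B = +-cancelʳ-<⇔ (B + + 1) {A - B - + 1} {t} {A} {t + (B + + 1)} (solve (A ∷ B ∷ [])) (solve (t ∷ B ∷ []))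

avoids-leg⇔ : ∀ a b t →
  (∀ i → 2 ℕ.≤ i → i ℕ.≤ suc b → csp (hook a b) i 1 ≢ t)
    ⇔ (1 ℕ.≤ b → t < + a - + b + + 1 ⊎ + a < t)
avoids-leg⇔ a b t = ⇔.trans (∀-range-cong solved-for-i)
  (⇔.trans (avoids-range⇔outside-range ((+ a + + 2) - t))
    (→-cong-⇔ (mk⇔ ℕ.s≤s⁻¹ s≤s) (⇔.trans (below (+ a) ⊎-⇔ above (+ a) (+ b)) (mk⇔ swap swap))))
  where
  solved-for-i : ∀ i → 2 ℕ.≤ i → i ℕ.≤ suc b → csp (hook a b) i 1 ≢ t ⇔ + i ≢ (+ a + + 2) - t
  solved-for-i i 2≤i i≤b rewrite csp-hook-leg {a} 2≤i i≤b = ¬-cong-⇔ (i-j≡k⇔j≡i-k (+ a + + 2) (+ i) t)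
  below : ∀ A → (A + + 2) - t < + 2 ⇔ A < t
  below A = +-cancelʳ-<⇔ (+ 2 - t) {A} {t} {(A + + 2) - t} {+ 2} (solve (A ∷ t ∷ [])) (solve (t ∷ []))
  -- stated with + 1 + B, which for B = + b is definitionally the bound + suc b
  above : ∀ A B → + 1 + B < (A + + 2) - t ⇔ t < A - B + + 1
  above A B = +-cancelʳ-<⇔ (B + + 1 - t) {t} {A - B + + 1} {+ 1 + B} {(A + + 2) - t} (solve (t ∷ B ∷ [])) (solve (A ∷ B ∷ t ∷ []))

proposition2p4 : (t : ℤ) (a b : ℕ) → 1 ℕ.≤ a →
    ((∀ i j → IsCell (hook a b) i j → csp (hook a b) i j ≢ t)
      ⇔ (((+ 2) ℤ.* (+ b) ≢ - t)
         × (2 ℕ.≤ a → ((+ b) < (+ 1) ℤ.- t) ⊎ ((+ a) ℤ.- (+ b) ℤ.- (+ 1) < t))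
         × (1 ℕ.≤ b → (t < (+ a) ℤ.- (+ b) ℤ.+ (+ 1)) ⊎ ((+ a) < t))))
proposition2p4 t (suc a) b _ = ⇔.trans
  (∀-hookCell⇔ a b (λ i j → csp (hook (suc a) b) i j ≢ t))
  (avoids-corner⇔ a b t ×-⇔ avoids-arm⇔ (suc a) b t ×-⇔ avoids-leg⇔ (suc a) b t)
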